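{- Let $m\ge 0$ and suppose the state $b=(b_1,\dots,b_m)$ can be obtained from $0^m=(0,\dots,0)$ by a (possibly empty) sequence of moves. Then for every $i\in\{0,1,\dots,m\}$, the state $(b_1,\dots,b_i,0,b_{i+1},\dots,b_m)\in\mathbb{N}^{m+1}$ (obtained by inserting a $0$ after the first $i$ entries) can be obtained from $0^{m+1}$ by a sequence of moves.
   Context: A state is a tuple $a=(a_1,\dots,a_m)$ of nonnegative integers. A move from a state $a$ to a state $a'$ is performed as follows: choose a triggering position $T$ with $a_T=0$; set $a'_T=2$; if there exists $j<T$ with $a_j>0$, take the largest such $j$ and set $a'_j=a_j-1$; if there exists $j>T$ with $a_j>0$, take the smallest such $j$ and set $a'_j=a_j-1$; all other entries are unchanged. -}

module Defs where

open import Data.Nat using (ℕ; zero; suc)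
open import Data.List using (List; []; _∷_; _++_; reverse; replicate; length)
open import Data.Product using (∃₂; _×_)
open import Relation.Binary.PropositionalEquality using (_≡_)
open import Relation.Binary.Construct.Closure.ReflexiveTransitive using (Star)

decFirst : List ℕ → List ℕ
decFirst []            = []
decFirst (zero  ∷ xs)  = zero ∷ decFirst xs
decFirst (suc k ∷ xs)  = k ∷ xs

decLast : List ℕ → List ℕ
decLast xs = reverse (decFirst (reverse xs))

-- One move: choose the trigger position T (a split a = L ++ 0 ∷ R, so a_T = 0),
-- set a_T := 2, decrement the nearest positive entry to the left (the largest j<T
-- with a_j>0, i.e. the last positive entry of L) and the nearest positive entry to
-- the right (the first positive entry of R); everything else unchanged.
data Move : List ℕ → List ℕ → Set where
  move : (L R : List ℕ) → Move (L ++ 0 ∷ R) (decLast L ++ 2 ∷ decFirst R)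

Reachable : List ℕ → List ℕ → Set
Reachable = Star Move

zeros : ℕ → List ℕ
zeros m = replicate m 0

{-# OPTIONS --safe #-}
module Submission where

-- A zero is inert under moves: it is never the nearest positive entry of a
-- trigger, so inserting a zero at a fixed position commutes with every move,
-- as long as the trigger is taken at the same original entry.  Inserting a
-- zero into a whole sequence of moves from 0^m therefore gives a sequence of
-- moves from 0^(m+1).

open import Defs
open import Data.Nat using (ℕ; zero; suc; _≤_; _+_; _∸_; s≤s)
open import Data.Nat.Properties using (_≤?_; ≰⇒>; +-suc; m≤n⇒∃[o]m+o≡n; m∸[m∸n]≡n)
open import Data.List using (List; []; _∷_; _++_; length; take; drop; reverse; [_])
open import Data.List.Properties
  using (length-reverse; length-drop; reverse-++; ++-assoc; take++drop≡id)
open import Data.Product using (_,_)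
open import Function using (_∘_)
open import Relation.Nullary using (yes; no)
open import Relation.Binary.PropositionalEquality
  using (_≡_; refl; sym; trans; cong; cong₂; subst; subst₂; module ≡-Reasoning)
open import Relation.Binary.Construct.Closure.ReflexiveTransitive using (gmap)

-- Past the end of the list the zero is appended.
insertZero : ℕ → List ℕ → List ℕ
insertZero k xs = take k xs ++ 0 ∷ drop k xs

insertZero-zeros : ∀ k m → insertZero k (zeros m) ≡ zeros (suc m)
insertZero-zeros zero    m       = refl
insertZero-zeros (suc k) zero    = refl
insertZero-zeros (suc k) (suc m) = cong (0 ∷_) (insertZero-zeros k m)

insertZero-length-++ : ∀ A C → insertZero (length A) (A ++ C) ≡ A ++ 0 ∷ C
insertZero-length-++ []      C = refl
insertZero-length-++ (x ∷ A) C = cong (x ∷_) (insertZero-length-++ A C)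

insertZero-++ˡ : ∀ {k} L M → k ≤ length L → insertZero k (L ++ M) ≡ insertZero k L ++ M
insertZero-++ˡ {zero}  L       M _         = refl
insertZero-++ˡ {suc k} (x ∷ L) M (s≤s k≤L) = cong (x ∷_) (insertZero-++ˡ L M k≤L)

insertZero-++ʳ : ∀ L j M → insertZero (length L + j) (L ++ M) ≡ L ++ insertZero j M
insertZero-++ʳ []      j M = refl
insertZero-++ʳ (x ∷ L) j M = cong (x ∷_) (insertZero-++ʳ L j M)

reverse-insertZero : ∀ k xs → reverse (insertZero k xs) ≡ insertZero (length xs ∸ k) (reverse xs)
reverse-insertZero k xs = begin
  reverse (T ++ 0 ∷ D)                     ≡⟨ reverse-++ T (0 ∷ D) ⟩
  reverse (0 ∷ D) ++ reverse T             ≡⟨ cong (_++ reverse T) (reverse-++ [ 0 ] D) ⟩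
  (reverse D ++ [ 0 ]) ++ reverse T        ≡⟨ ++-assoc (reverse D) [ 0 ] (reverse T) ⟩
  reverse D ++ 0 ∷ reverse T               ≡⟨ sym (insertZero-length-++ (reverse D) (reverse T)) ⟩
  insertZero (length (reverse D)) (reverse D ++ reverse T)
    ≡⟨ cong₂ insertZero (trans (length-reverse D) (length-drop k xs))
                        (trans (sym (reverse-++ T D)) (cong reverse (take++drop≡id k xs))) ⟩
  insertZero (length xs ∸ k) (reverse xs)  ∎
  where
  open ≡-Reasoning
  T = take k xs
  D = drop k xs

length-decFirst : ∀ xs → length (decFirst xs) ≡ length xs
length-decFirst []           = refl
length-decFirst (zero  ∷ xs) = cong suc (length-decFirst xs)
length-decFirst (suc _ ∷ xs) = refl

length-decLast : ∀ xs → length (decLast xs) ≡ length xs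
length-decLast xs = trans (length-reverse (decFirst (reverse xs)))
                          (trans (length-decFirst (reverse xs)) (length-reverse xs))

decFirst-insertZero : ∀ k xs → decFirst (insertZero k xs) ≡ insertZero k (decFirst xs)
decFirst-insertZero zero    xs           = refl
decFirst-insertZero (suc k) []           = refl
decFirst-insertZero (suc k) (zero  ∷ xs) = cong (0 ∷_) (decFirst-insertZero k xs)
decFirst-insertZero (suc k) (suc _ ∷ xs) = refl

-- Unlike decFirst, the bound is needed here: reversing turns position k into length xs ∸ k.
decLast-insertZero : ∀ {k} xs → k ≤ length xs → decLast (insertZero k xs) ≡ insertZero k (decLast xs)
decLast-insertZero {k} xs k≤n = begin
  reverse (decFirst (reverse (insertZero k xs)))
    ≡⟨ cong (reverse ∘ decFirst) (reverse-insertZero k xs) ⟩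
  reverse (decFirst (insertZero (n ∸ k) (reverse xs)))
    ≡⟨ cong reverse (decFirst-insertZero (n ∸ k) (reverse xs)) ⟩
  reverse (insertZero (n ∸ k) (decFirst (reverse xs)))
    ≡⟨ reverse-insertZero (n ∸ k) (decFirst (reverse xs)) ⟩
  insertZero (length (decFirst (reverse xs)) ∸ (n ∸ k)) (decLast xs)
    ≡⟨ cong (λ j → insertZero (j ∸ (n ∸ k)) (decLast xs))
            (trans (length-decFirst (reverse xs)) (length-reverse xs)) ⟩
  insertZero (n ∸ (n ∸ k)) (decLast xs)
    ≡⟨ cong (λ j → insertZero j (decLast xs)) (m∸[m∸n]≡n k≤n) ⟩
  insertZero k (decLast xs)  ∎
  where
  open ≡-Reasoning
  n = length xs

move-insertZero : ∀ k {a b} → Move a b → Move (insertZero k a) (insertZero k b)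
move-insertZero k (move L R) with k ≤? length L
... | yes k≤L = subst₂ Move (sym (insertZero-++ˡ L (0 ∷ R) k≤L)) target (move (insertZero k L) R)
  where
  target : decLast (insertZero k L) ++ 2 ∷ decFirst R ≡ insertZero k (decLast L ++ 2 ∷ decFirst R)
  target = trans (cong (_++ 2 ∷ decFirst R) (decLast-insertZero L k≤L))
                 (sym (insertZero-++ˡ (decLast L) (2 ∷ decFirst R)
                        (subst (k ≤_) (sym (length-decLast L)) k≤L)))
... | no k≰L with m≤n⇒∃[o]m+o≡n (≰⇒> k≰L)
...   | j , 1+L+j≡k = subst (λ i → Move (insertZero i _) (insertZero i _)) k≡L+1+j beyondTrigger
  where
  k≡L+1+j : length L + suc j ≡ k
  k≡L+1+j = trans (+-suc (length L) j) 1+L+j≡k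

  beyondTrigger : Move (insertZero (length L + suc j) (L ++ 0 ∷ R))
                       (insertZero (length L + suc j) (decLast L ++ 2 ∷ decFirst R))
  beyondTrigger = subst₂ Move (sym (insertZero-++ʳ L (suc j) (0 ∷ R))) target (move L (insertZero j R))
    where
    target : decLast L ++ 2 ∷ decFirst (insertZero j R)
           ≡ insertZero (length L + suc j) (decLast L ++ 2 ∷ decFirst R)
    target = begin
      decLast L ++ 2 ∷ decFirst (insertZero j R)
        ≡⟨ cong (λ ys → decLast L ++ 2 ∷ ys) (decFirst-insertZero j R) ⟩
      decLast L ++ insertZero (suc j) (2 ∷ decFirst R)
        ≡⟨ sym (insertZero-++ʳ (decLast L) (suc j) (2 ∷ decFirst R)) ⟩
      insertZero (length (decLast L) + suc j) (decLast L ++ 2 ∷ decFirst R)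
        ≡⟨ cong (λ l → insertZero (l + suc j) (decLast L ++ 2 ∷ decFirst R)) (length-decLast L) ⟩
      insertZero (length L + suc j) (decLast L ++ 2 ∷ decFirst R)  ∎
      where open ≡-Reasoning

reachable-insertZero : ∀ k {a b} → Reachable a b → Reachable (insertZero k a) (insertZero k b)
reachable-insertZero k = gmap (insertZero k) (move-insertZero k)

mainTheorem4 : (m : ℕ) (b : List ℕ) → length b ≡ m →
    Reachable (zeros m) b →
    (i : ℕ) → i ≤ m →
    Reachable (zeros (suc m)) (take i b ++ 0 ∷ drop i b)
mainTheorem4 m b _ reach i _ =
  subst (λ z → Reachable z (insertZero i b)) (insertZero-zeros i m) (reachable-insertZero i reach)
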